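{- For every positive integer $k$, $\beta(k)\ge k+2$. Further, when $k\ge 4$, $\beta(k)\ge k+3$.
   Context: For positive integers $k, s_1, s_2$ consider the diophantine system $$\sum_{i=1}^{s_1} x_i^r=\sum_{i=1}^{s_2} y_i^r,\qquad r=1,2,\ldots,k,$$ in integers $x_1,\dots,x_{s_1},y_1,\dots,y_{s_2}$. Arrange (by interchanging the two sides if necessary) that $s_1\le s_2$. A solution is called trivial if $y_i=0$ for $s_2-s_1$ values of $i$ and the remaining $s_1$ integers $y_i$ are a permutation of $x_1,\dots,x_{s_1}$; otherwise it is nontrivial. $\beta(k)$ denotes the minimum value of $s_1+s_2$ (over all positive integers $s_1,s_2$) for which this system has a nontrivial integer solution. -}

module Defs where

open import Data.Nat using (ℕ; _≤_; _∸_)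
open import Data.Integer using (ℤ; _+_; _^_; 0ℤ)
open import Data.List using (List; foldr; map; _++_; replicate)
open import Data.Vec using (Vec; toList)
open import Data.Product using (_×_)
open import Data.Sum using (_⊎_)
open import Relation.Binary.PropositionalEquality using (_≡_)
open import Data.List.Relation.Binary.Permutation.Propositional using (_↭_)

sumℤ : List ℤ → ℤ
sumℤ = foldr _+_ 0ℤ

powerSum : ∀ {s} → ℕ → Vec ℤ s → ℤ
powerSum r v = sumℤ (map (λ a → a ^ r) (toList v))

IsSolution : ∀ {s₁ s₂} → ℕ → Vec ℤ s₁ → Vec ℤ s₂ → Set
IsSolution k x y = ∀ r → 1 ≤ r → r ≤ k → powerSum r x ≡ powerSum r y

TrivialOrd : ∀ {s₁ s₂} → Vec ℤ s₁ → Vec ℤ s₂ → Set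
TrivialOrd {s₁} {s₂} x y = toList y ↭ (toList x ++ replicate (s₂ ∸ s₁) 0ℤ)

Trivial : ∀ {s₁ s₂} → Vec ℤ s₁ → Vec ℤ s₂ → Set
Trivial {s₁} {s₂} x y = (s₁ ≤ s₂ × TrivialOrd x y) ⊎ (s₂ ≤ s₁ × TrivialOrd y x)

-- β(k) ≥ b  ⇔  no nontrivial solution with positive s₁, s₂ and s₁ + s₂ < b
βAtLeast : ℕ → ℕ → Set
βAtLeast k b = ∀ s₁ s₂ → 1 ≤ s₁ → 1 ≤ s₂ → s₁ Data.Nat.+ s₂ Data.Nat.< b →
  (x : Vec ℤ s₁) (y : Vec ℤ s₂) → IsSolution k x y → Trivial x y

{-# OPTIONS --safe #-}
module Submission where

-- If s₁ ≤ s₂ ≤ k, pad x with zeros to length s₂: the two lists of length s₂ then have the same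
-- power sums of orders 1, …, s₂. By Newton's identities these determine the elementary symmetric
-- functions, hence by Vieta the polynomial ∏ (t - a), hence the multiset; so the solution is trivial,
-- and β(k) ≥ k + 2. For β(k) ≥ k + 3 the only new case is s₁ = 1, s₂ = k + 1 with k ≥ 4. Then
-- Σ y = c, Σ y² = c² and Σ y⁴ = c⁴ give (Σ y²)² = Σ y⁴, so at most one y is nonzero, and it equals c.

open import Defs
open import Data.Product using (_×_; _,_; ∃; proj₁; proj₂)
open import Data.Sum using (inj₁; inj₂)
open import Data.List using (List; []; _∷_; _++_; length; map; replicate)
open import Data.List.Properties using (map-cong; length-++; length-replicate)
open import Data.List.Membership.Propositional using (_∈_)
open import Data.List.Membership.Propositional.Properties using (∈-∃++)
open import Data.List.Relation.Unary.Any using (here; there)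
open import Data.List.Relation.Binary.Permutation.Propositional as ↭
  using (_↭_; prep; swap; ↭-refl; ↭-sym; ↭-trans; ↭-reflexive; ↭⇒↭ₛ)
open import Data.List.Relation.Binary.Permutation.Propositional.Properties
  using (shift; map⁺; ↭-length)
open import Data.List.Relation.Binary.Permutation.Setoid.Properties
  using (foldr-commMonoid)
open import Data.Vec using (Vec; toList; []; _∷_)
open import Data.Vec.Properties using (length-toList)
open import Relation.Binary.PropositionalEquality
  using (_≡_; refl; sym; trans; cong; cong₂; subst; setoid; module ≡-Reasoning)

module SumsOfSquares where
  open import Data.Nat using (ℕ; _+_; _*_; _≤_; z≤n)
  open import Data.Nat.ListAction using (sum)
  open import Data.Nat.Properties
    using (+-monoʳ-≤; ≤-trans; m≤n+m; +-cancelˡ-≡; +-cancelʳ-≤; n≤0⇒n≡0; m+n≡0⇒m≡0; module ≤-Reasoning)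
  open import Data.Nat.Tactic.RingSolver using (solve-∀)

  sumSquares : List ℕ → ℕ
  sumSquares ns = sum (map (λ n → n * n) ns)

  private
    square-+ : ∀ m n → (m + n) * (m + n) ≡ m * m + ((m * n + m * n) + n * n)
    square-+ = solve-∀

  sumSquares≤sum² : ∀ ns → sumSquares ns ≤ sum ns * sum ns
  sumSquares≤sum² [] = z≤n
  sumSquares≤sum² (n ∷ ns) = begin
      n * n + sumSquares ns
        ≤⟨ +-monoʳ-≤ (n * n) (≤-trans (sumSquares≤sum² ns) (m≤n+m (s * s) (n * s + n * s))) ⟩
      n * n + ((n * s + n * s) + s * s)
        ≡⟨ square-+ n s ⟨
      (n + s) * (n + s) ∎
    where
    open ≤-Reasoning
    s = sum ns

  sum²≡sumSquares-∷ : ∀ n ns → (n + sum ns) * (n + sum ns) ≡ sumSquares (n ∷ ns) →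
    n * sum ns ≡ 0 × sum ns * sum ns ≡ sumSquares ns
  sum²≡sumSquares-∷ n ns eq = m+n≡0⇒m≡0 (n * s) cross≡0 , trans (cong (_+ s * s) (sym cross≡0)) rest
    where
    s = sum ns
    rest : (n * s + n * s) + s * s ≡ sumSquares ns
    rest = +-cancelˡ-≡ (n * n) _ _ (trans (sym (square-+ n s)) eq)
    cross≡0 : n * s + n * s ≡ 0
    cross≡0 = n≤0⇒n≡0 (+-cancelʳ-≤ (s * s) _ 0 (subst (_≤ s * s) (sym rest) (sumSquares≤sum² ns)))

module PowerSums where
  open import Data.Nat as ℕ using (ℕ; zero; suc; _≤_; z≤n; s≤s; s≤s⁻¹)
  open import Data.Nat.ListAction using (sum)
  open import Data.Nat.Properties
    using (≤-refl; <⇒≤; m≤n⇒m≤1+n; m≤n⇒m<n∨m≡n; m+n≤o⇒m≤o; +-suc; m*n≡0⇒m≡0∨n≡0;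
           m+n≡0⇒m≡0; m+n≡0⇒n≡0; suc-injective)
  open import Data.Integer using (ℤ; +_; -[1+_]; 0ℤ; 1ℤ; _+_; _-_; _*_; -_; _^_; ∣_∣)
  open import Data.Integer.Properties
    using (+-0-isCommutativeMonoid; *-zeroʳ; *-zeroˡ; *-identityʳ; +-identityʳ; +◃n≡+n; pos-*; +-injective;
           ^-*-assoc; i*j≡0⇒i≡0∨j≡0; i-j≡0⇒i≡j; +-inverseʳ; *-cancelˡ-≡; ∣i∣≡0⇒i≡0; neg-distribˡ-*)
  open import Data.Integer.Tactic.RingSolver using (solve-∀)
  open SumsOfSquares

  powerSumᴸ : ℕ → List ℤ → ℤ
  powerSumᴸ r l = sumℤ (map (_^ r) l)

  PowerSumsAgree : ℕ → List ℤ → List ℤ → Set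
  PowerSumsAgree n a b = ∀ r → 1 ≤ r → r ≤ n → powerSumᴸ r a ≡ powerSumᴸ r b

  sumℤ-map-+ : ∀ (f g : ℤ → ℤ) l → sumℤ (map (λ a → f a + g a) l) ≡ sumℤ (map f l) + sumℤ (map g l)
  sumℤ-map-+ f g [] = refl
  sumℤ-map-+ f g (a ∷ l) = trans (cong (_+_ (f a + g a)) (sumℤ-map-+ f g l)) (interchange (f a) (g a) _ _)
    where
    interchange : ∀ x y u v → (x + y) + (u + v) ≡ (x + u) + (y + v)
    interchange = solve-∀

  sumℤ-map-*ˡ : ∀ c (f : ℤ → ℤ) l → sumℤ (map (λ a → c * f a) l) ≡ c * sumℤ (map f l)
  sumℤ-map-*ˡ c f [] = sym (*-zeroʳ c)
  sumℤ-map-*ˡ c f (a ∷ l) = trans (cong (_+_ (c * f a)) (sumℤ-map-*ˡ c f l)) (distrib c (f a) _)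
    where
    distrib : ∀ c x s → c * x + c * s ≡ c * (x + s)
    distrib = solve-∀

  powerSumᴸ-↭ : ∀ r {a b} → a ↭ b → powerSumᴸ r a ≡ powerSumᴸ r b
  powerSumᴸ-↭ r p = foldr-commMonoid (setoid ℤ) +-0-isCommutativeMonoid (↭⇒↭ₛ (map⁺ (_^ r) p))

  powerSumᴸ-zeros : ∀ r n → powerSumᴸ (suc r) (replicate n 0ℤ) ≡ 0ℤ
  powerSumᴸ-zeros r zero = refl
  powerSumᴸ-zeros r (suc n) = cong₂ _+_ (*-zeroˡ (0ℤ ^ r)) (powerSumᴸ-zeros r n)

  powerSumᴸ-padded : ∀ r a n → powerSumᴸ (suc r) (a ++ replicate n 0ℤ) ≡ powerSumᴸ (suc r) a
  powerSumᴸ-padded r [] n = powerSumᴸ-zeros r n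
  powerSumᴸ-padded r (x ∷ a) n = cong (_+_ (x ^ suc r)) (powerSumᴸ-padded r a n)

  -- σ l j is (-1)^j times the j-th elementary symmetric polynomial of l,
  -- i.e. the coefficient of t^(length l ∸ j) in ∏_{a ∈ l} (t - a).
  σ : List ℤ → ℕ → ℤ
  σ l zero = 1ℤ
  σ [] (suc j) = 0ℤ
  σ (a ∷ l) (suc j) = σ l (suc j) - a * σ l j

  σ-beyond-length : ∀ l j → length l ≤ j → σ l (suc j) ≡ 0ℤ
  σ-beyond-length [] j _ = refl
  σ-beyond-length (a ∷ l) (suc j) (s≤s |l|≤j)
    rewrite σ-beyond-length l (suc j) (m≤n⇒m≤1+n |l|≤j) | σ-beyond-length l j |l|≤j | *-zeroʳ a = refl

  σ-↭ : ∀ {a b} → a ↭ b → ∀ j → σ a j ≡ σ b j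
  σ-↭ ↭.refl j = refl
  σ-↭ (prep x p) zero = refl
  σ-↭ (prep x p) (suc j) = cong₂ (λ u v → u - x * v) (σ-↭ p (suc j)) (σ-↭ p j)
  σ-↭ (swap x y p) zero = refl
  σ-↭ {b = _ ∷ _ ∷ b} (swap x y p) (suc zero) rewrite σ-↭ p 1 = exchange (σ b 1) x y
    where
    exchange : ∀ s x y → (s - y * + 1) - x * + 1 ≡ (s - x * + 1) - y * + 1
    exchange = solve-∀
  σ-↭ {b = _ ∷ _ ∷ b} (swap x y p) (suc (suc j))
    rewrite σ-↭ p (suc (suc j)) | σ-↭ p (suc j) | σ-↭ p j =
      exchange (σ b (suc (suc j))) (σ b (suc j)) (σ b j) x y
    where
    exchange : ∀ s₂ s₁ s₀ x y → (s₂ - y * s₁) - x * (s₁ - y * s₀) ≡ (s₂ - x * s₁) - y * (s₁ - x * s₀)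
    exchange = solve-∀
  σ-↭ (↭.trans p q) j = trans (σ-↭ p j) (σ-↭ q j)

  σ-∷-cancel : ∀ x a b n → (∀ j → j ≤ n → σ (x ∷ a) j ≡ σ (x ∷ b) j) → ∀ j → j ≤ n → σ a j ≡ σ b j
  σ-∷-cancel x a b n eq zero _ = refl
  σ-∷-cancel x a b n eq (suc j) j<n = begin
      σ a (suc j)
        ≡⟨ sub-add (σ a (suc j)) (x * σ a j) ⟩
      σ (x ∷ a) (suc j) + x * σ a j
        ≡⟨ cong₂ (λ u v → u + x * v) (eq (suc j) j<n) (σ-∷-cancel x a b n eq j (<⇒≤ j<n)) ⟩
      σ (x ∷ b) (suc j) + x * σ b j
        ≡⟨ sub-add (σ b (suc j)) (x * σ b j) ⟨
      σ b (suc j) ∎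
    where
    open ≡-Reasoning
    sub-add : ∀ u v → u ≡ (u - v) + v
    sub-add = solve-∀

  horner : ℕ → (ℕ → ℤ) → ℤ → ℤ
  horner zero c t = c 0
  horner (suc n) c t = t * horner n c t + c (suc n)

  horner-cong : ∀ n c d t → (∀ j → j ≤ n → c j ≡ d j) → horner n c t ≡ horner n d t
  horner-cong zero c d t eq = eq 0 z≤n
  horner-cong (suc n) c d t eq =
    cong₂ (λ h e → t * h + e)
      (horner-cong n c d t (λ j j≤n → eq j (m≤n⇒m≤1+n j≤n))) (eq (suc n) ≤-refl)

  horner-σ-∷ : ∀ n b l t → horner (suc n) (σ (b ∷ l)) t ≡ (t - b) * horner n (σ l) t + σ l (suc n)
  horner-σ-∷ zero b l t = factor t b (σ l 1)
    where
    factor : ∀ t b s → t * + 1 + (s - b * + 1) ≡ (t - b) * + 1 + s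
    factor = solve-∀
  horner-σ-∷ (suc n) b l t = begin
      t * horner (suc n) (σ (b ∷ l)) t + (σ l (suc (suc n)) - b * σ l (suc n))
        ≡⟨ cong (λ h → t * h + _) (horner-σ-∷ n b l t) ⟩
      t * ((t - b) * horner n (σ l) t + σ l (suc n)) + (σ l (suc (suc n)) - b * σ l (suc n))
        ≡⟨ factor t b (horner n (σ l) t) (σ l (suc n)) (σ l (suc (suc n))) ⟩
      (t - b) * horner (suc n) (σ l) t + σ l (suc (suc n)) ∎
    where
    open ≡-Reasoning
    factor : ∀ t b h s₁ s₂ → t * ((t - b) * h + s₁) + (s₂ - b * s₁) ≡ (t - b) * (t * h + s₁) + s₂
    factor = solve-∀

  rootProduct : List ℤ → ℤ → ℤ
  rootProduct [] t = 1ℤ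
  rootProduct (a ∷ l) t = (t - a) * rootProduct l t

  vieta : ∀ l t → horner (length l) (σ l) t ≡ rootProduct l t
  vieta [] t = refl
  vieta (b ∷ l) t = begin
      horner (suc (length l)) (σ (b ∷ l)) t
        ≡⟨ horner-σ-∷ (length l) b l t ⟩
      (t - b) * horner (length l) (σ l) t + σ l (suc (length l))
        ≡⟨ cong₂ (λ h e → (t - b) * h + e) (vieta l t) (σ-beyond-length l (length l) ≤-refl) ⟩
      (t - b) * rootProduct l t + 0ℤ
        ≡⟨ +-identityʳ _ ⟩
      (t - b) * rootProduct l t ∎
    where open ≡-Reasoning

  rootProduct≡0⇒∈ : ∀ l t → rootProduct l t ≡ 0ℤ → t ∈ l
  rootProduct≡0⇒∈ (a ∷ l) t eq with i*j≡0⇒i≡0∨j≡0 (t - a) eq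
  ... | inj₁ t-a≡0 = here (i-j≡0⇒i≡j t a t-a≡0)
  ... | inj₂ rest≡0 = there (rootProduct≡0⇒∈ l t rest≡0)

  σ-agree⇒∈ : ∀ x a b → length (x ∷ a) ≡ length b →
    (∀ j → j ≤ length (x ∷ a) → σ (x ∷ a) j ≡ σ b j) → x ∈ b
  σ-agree⇒∈ x a b len eq = rootProduct≡0⇒∈ b x (begin
      rootProduct b x                                ≡⟨ vieta b x ⟨
      horner (length b) (σ b) x                      ≡⟨ cong (λ n → horner n (σ b) x) len ⟨
      horner (length (x ∷ a)) (σ b) x                ≡⟨ horner-cong _ _ _ x eq ⟨
      horner (length (x ∷ a)) (σ (x ∷ a)) x          ≡⟨ vieta (x ∷ a) x ⟩
      (x - x) * rootProduct a x                      ≡⟨ cong (_* rootProduct a x) (+-inverseʳ x) ⟩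
      0ℤ * rootProduct a x                           ≡⟨ *-zeroˡ (rootProduct a x) ⟩
      0ℤ ∎)
    where open ≡-Reasoning

  σ-agree⇒↭ : ∀ a b → length a ≡ length b → (∀ j → j ≤ length a → σ a j ≡ σ b j) → a ↭ b
  σ-agree⇒↭ [] [] _ _ = ↭-refl
  σ-agree⇒↭ (x ∷ a) b len eq with ∈-∃++ (σ-agree⇒∈ x a b len eq)
  ... | ys , zs , refl = ↭-trans (prep x (σ-agree⇒↭ a (ys ++ zs) len′ eq′)) (↭-sym x∷ys++zs)
    where
    x∷ys++zs : ys ++ x ∷ zs ↭ x ∷ ys ++ zs
    x∷ys++zs = shift x ys zs
    len′ : length a ≡ length (ys ++ zs)
    len′ = suc-injective (trans len (↭-length x∷ys++zs))
    eq′ : ∀ j → j ≤ length a → σ a j ≡ σ (ys ++ zs) j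
    eq′ = σ-∷-cancel x a (ys ++ zs) (length a)
      (λ j j≤|a| → trans (eq j (m≤n⇒m≤1+n j≤|a|)) (σ-↭ x∷ys++zs j))

  hornerMoment : ℕ → ℕ → (ℕ → ℤ) → List ℤ → ℤ
  hornerMoment m k c l = sumℤ (map (λ a → horner k c a * a ^ m) l)

  hornerMoment-suc : ∀ m k c l →
    hornerMoment m (suc k) c l ≡ hornerMoment (suc m) k c l + c (suc k) * powerSumᴸ m l
  hornerMoment-suc m k c l = begin
      hornerMoment m (suc k) c l
        ≡⟨ cong sumℤ (map-cong (λ a → shift-power a (horner k c a) (c (suc k)) (a ^ m)) l) ⟩
      sumℤ (map (λ a → horner k c a * a ^ suc m + c (suc k) * a ^ m) l)
        ≡⟨ sumℤ-map-+ _ _ l ⟩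
      hornerMoment (suc m) k c l + sumℤ (map (λ a → c (suc k) * a ^ m) l)
        ≡⟨ cong (_+_ (hornerMoment (suc m) k c l)) (sumℤ-map-*ˡ (c (suc k)) (_^ m) l) ⟩
      hornerMoment (suc m) k c l + c (suc k) * powerSumᴸ m l ∎
    where
    open ≡-Reasoning
    shift-power : ∀ a h e p → (a * h + e) * p ≡ h * (a * p) + e * p
    shift-power = solve-∀

  PowerSumsAgree⇒hornerMoment≡ : ∀ {n} a b → PowerSumsAgree n a b →
    ∀ k m c → 1 ≤ m → m ℕ.+ k ≤ n → hornerMoment m k c a ≡ hornerMoment m k c b
  PowerSumsAgree⇒hornerMoment≡ a b agree zero m c 1≤m m+0≤n = begin
      hornerMoment m zero c a   ≡⟨ sumℤ-map-*ˡ (c 0) (_^ m) a ⟩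
      c 0 * powerSumᴸ m a       ≡⟨ cong (c 0 *_) (agree m 1≤m (m+n≤o⇒m≤o m m+0≤n)) ⟩
      c 0 * powerSumᴸ m b       ≡⟨ sumℤ-map-*ˡ (c 0) (_^ m) b ⟨
      hornerMoment m zero c b   ∎
    where open ≡-Reasoning
  PowerSumsAgree⇒hornerMoment≡ {n} a b agree (suc k) m c 1≤m m+1+k≤n = begin
      hornerMoment m (suc k) c a
        ≡⟨ hornerMoment-suc m k c a ⟩
      hornerMoment (suc m) k c a + c (suc k) * powerSumᴸ m a
        ≡⟨ cong₂ (λ u v → u + c (suc k) * v)
             (PowerSumsAgree⇒hornerMoment≡ a b agree k (suc m) c (s≤s z≤n)
               (subst (_≤ n) (+-suc m k) m+1+k≤n))
             (agree m 1≤m (m+n≤o⇒m≤o m m+1+k≤n)) ⟩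
      hornerMoment (suc m) k c b + c (suc k) * powerSumᴸ m b
        ≡⟨ hornerMoment-suc m k c b ⟨
      hornerMoment m (suc k) c b ∎
    where open ≡-Reasoning

  hornerMoment-cong : ∀ m k c d l → (∀ j → j ≤ k → c j ≡ d j) →
    hornerMoment m k c l ≡ hornerMoment m k d l
  hornerMoment-cong m k c d l eq = cong sumℤ (map-cong (λ a → cong (_* a ^ m) (horner-cong k c d a eq)) l)

  hornerMoment-σ-∷ : ∀ m k b l l′ →
    hornerMoment m (suc k) (σ (b ∷ l)) l′ ≡ hornerMoment m (suc k) (σ l) l′ - b * hornerMoment m k (σ l) l′
  hornerMoment-σ-∷ m k b l l′ = begin
      hornerMoment m (suc k) (σ (b ∷ l)) l′
        ≡⟨ cong sumℤ (map-cong pointwise l′) ⟩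
      sumℤ (map (λ a → horner (suc k) (σ l) a * a ^ m + (- b) * (horner k (σ l) a * a ^ m)) l′)
        ≡⟨ sumℤ-map-+ _ _ l′ ⟩
      hornerMoment m (suc k) (σ l) l′ + sumℤ (map (λ a → (- b) * (horner k (σ l) a * a ^ m)) l′)
        ≡⟨ cong (_+_ (hornerMoment m (suc k) (σ l) l′)) (sumℤ-map-*ˡ (- b) _ l′) ⟩
      hornerMoment m (suc k) (σ l) l′ + (- b) * hornerMoment m k (σ l) l′
        ≡⟨ cong (_+_ (hornerMoment m (suc k) (σ l) l′)) (neg-distribˡ-* b _) ⟨
      hornerMoment m (suc k) (σ l) l′ - b * hornerMoment m k (σ l) l′ ∎
    where
    open ≡-Reasoning
    expand : ∀ a b h s p → ((a - b) * h + s) * p ≡ (a * h + s) * p + (- b) * (h * p)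
    expand = solve-∀
    pointwise : ∀ a → horner (suc k) (σ (b ∷ l)) a * a ^ m
                    ≡ horner (suc k) (σ l) a * a ^ m + (- b) * (horner k (σ l) a * a ^ m)
    pointwise a = trans (cong (_* a ^ m) (horner-σ-∷ k b l a)) (expand a b _ _ _)

  -- Newton's identities: hornerMoment 1 k (σ l) l is Σ_{i ≤ k} σ_i p_{k+1-i}, with p_r the power sums.
  newton : ∀ k l → + suc k * σ l (suc k) ≡ - hornerMoment 1 k (σ l) l
  newton k [] = *-zeroʳ (+ suc k)
  newton zero (b ∷ l) = begin
      + 1 * (σ l 1 - b * + 1)               ≡⟨ expand (σ l 1) b ⟩
      + 1 * σ l 1 - + 1 * (b * + 1)         ≡⟨ cong (_- _) (newton zero l) ⟩
      - M - + 1 * (b * + 1)                 ≡⟨ collect M b ⟩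
      - (+ 1 * (b * + 1) + M) ∎
    where
    open ≡-Reasoning
    M = hornerMoment 1 zero (σ l) l
    expand : ∀ s b → + 1 * (s - b * + 1) ≡ + 1 * s - + 1 * (b * + 1)
    expand = solve-∀
    collect : ∀ M x → - M - + 1 * (x * + 1) ≡ - (+ 1 * (x * + 1) + M)
    collect = solve-∀
  newton (suc k) (b ∷ l) = begin
      + suc (suc k) * (s₂ - b * s₁)
        ≡⟨ expand (+ suc k) s₂ s₁ b ⟩
      + suc (suc k) * s₂ - b * (+ suc k * s₁) - b * s₁
        ≡⟨ cong₂ (λ u v → u - b * v - b * s₁) (newton (suc k) l) (newton k l) ⟩
      - M₁ - b * - M₀ - b * s₁
        ≡⟨ collect b s₁ M₁ M₀ (horner k (σ l) b) ⟩
      - (((b - b) * horner k (σ l) b + s₁) * (b ^ 1) + (M₁ - b * M₀))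
        ≡⟨ cong₂ (λ h M → - (h * b ^ 1 + M)) (horner-σ-∷ k b l b) (hornerMoment-σ-∷ 1 k b l l) ⟨
      - hornerMoment 1 (suc k) (σ (b ∷ l)) (b ∷ l) ∎
    where
    open ≡-Reasoning
    s₁ = σ l (suc k)
    s₂ = σ l (suc (suc k))
    M₀ = hornerMoment 1 k (σ l) l
    M₁ = hornerMoment 1 (suc k) (σ l) l
    expand : ∀ n s₂ s₁ b → (+ 1 + n) * (s₂ - b * s₁) ≡ (+ 1 + n) * s₂ - b * (n * s₁) - b * s₁
    expand = solve-∀
    collect : ∀ b s₁ M₁ M₀ h →
      - M₁ - b * - M₀ - b * s₁ ≡ - (((b - b) * h + s₁) * (b * + 1) + (M₁ - b * M₀))
    collect = solve-∀

  PowerSumsAgree⇒σ-agree : ∀ {n} a b → PowerSumsAgree n a b → ∀ i → i ≤ n → σ a i ≡ σ b i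
  PowerSumsAgree⇒σ-agree {n} a b agree = upTo n ≤-refl
    where
    open ≡-Reasoning
    upTo : ∀ j → j ≤ n → ∀ i → i ≤ j → σ a i ≡ σ b i
    upTo zero _ zero _ = refl
    upTo (suc j) j<n i i≤1+j with m≤n⇒m<n∨m≡n i≤1+j
    ... | inj₁ i≤j = upTo j (<⇒≤ j<n) i (s≤s⁻¹ i≤j)
    ... | inj₂ refl = *-cancelˡ-≡ (+ suc j) _ _ (begin
      + suc j * σ a (suc j)        ≡⟨ newton j a ⟩
      - hornerMoment 1 j (σ a) a   ≡⟨ cong -_ (PowerSumsAgree⇒hornerMoment≡ a b agree j 1 (σ a) (s≤s z≤n) j<n) ⟩
      - hornerMoment 1 j (σ a) b   ≡⟨ cong -_ (hornerMoment-cong 1 j (σ a) (σ b) b (upTo j (<⇒≤ j<n))) ⟩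
      - hornerMoment 1 j (σ b) b   ≡⟨ newton j b ⟨
      + suc j * σ b (suc j)        ∎)

  PowerSumsAgree⇒↭ : ∀ {n a b} → length a ≡ n → length b ≡ n → PowerSumsAgree n a b → a ↭ b
  PowerSumsAgree⇒↭ {n} {a} {b} refl |b|≡n agree =
    σ-agree⇒↭ a b (sym |b|≡n) (PowerSumsAgree⇒σ-agree a b agree)

  sqAbs : ℤ → ℕ
  sqAbs z = ∣ z ∣ ℕ.* ∣ z ∣

  ^2≡sqAbs : ∀ z → z ^ 2 ≡ + sqAbs z
  ^2≡sqAbs z = trans (cong (z *_) (*-identityʳ z)) (square z)
    where
    square : ∀ z → z * z ≡ + sqAbs z
    square (+ n) = +◃n≡+n _
    square -[1+ n ] = +◃n≡+n _

  powerSumᴸ-2 : ∀ l → powerSumᴸ 2 l ≡ + sum (map sqAbs l)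
  powerSumᴸ-2 [] = refl
  powerSumᴸ-2 (z ∷ w) = cong₂ _+_ (^2≡sqAbs z) (powerSumᴸ-2 w)

  powerSumᴸ-4 : ∀ l → powerSumᴸ 4 l ≡ + sumSquares (map sqAbs l)
  powerSumᴸ-4 [] = refl
  powerSumᴸ-4 (z ∷ w) = cong₂ _+_ fourth (powerSumᴸ-4 w)
    where
    open ≡-Reasoning
    fourth : z ^ 4 ≡ + (sqAbs z ℕ.* sqAbs z)
    fourth = begin
      z ^ 4               ≡⟨ ^-*-assoc z 2 2 ⟨
      (z ^ 2) ^ 2         ≡⟨ cong (_^ 2) (^2≡sqAbs z) ⟩
      (+ sqAbs z) ^ 2     ≡⟨ ^2≡sqAbs (+ sqAbs z) ⟩
      + (sqAbs z ℕ.* sqAbs z) ∎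

  sqAbs≡0⇒≡0 : ∀ z → sqAbs z ≡ 0 → z ≡ 0ℤ
  sqAbs≡0⇒≡0 z eq with m*n≡0⇒m≡0∨n≡0 ∣ z ∣ eq
  ... | inj₁ ∣z∣≡0 = ∣i∣≡0⇒i≡0 ∣z∣≡0
  ... | inj₂ ∣z∣≡0 = ∣i∣≡0⇒i≡0 ∣z∣≡0

  sum-sqAbs≡0⇒zeros : ∀ w → sum (map sqAbs w) ≡ 0 → w ≡ replicate (length w) 0ℤ
  sum-sqAbs≡0⇒zeros [] _ = refl
  sum-sqAbs≡0⇒zeros (z ∷ w) eq =
    cong₂ _∷_ (sqAbs≡0⇒≡0 z (m+n≡0⇒m≡0 (sqAbs z) eq)) (sum-sqAbs≡0⇒zeros w (m+n≡0⇒n≡0 (sqAbs z) eq))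

  sum²≡sumSquares⇒oneNonzero : ∀ z w →
    sum (map sqAbs (z ∷ w)) ℕ.* sum (map sqAbs (z ∷ w)) ≡ sumSquares (map sqAbs (z ∷ w)) →
    ∃ λ u → z ∷ w ↭ u ∷ replicate (length w) 0ℤ
  sum²≡sumSquares⇒oneNonzero z [] _ = z , ↭-refl
  sum²≡sumSquares⇒oneNonzero z (z′ ∷ w) eq with sum²≡sumSquares-∷ (sqAbs z) (map sqAbs (z′ ∷ w)) eq
  ... | cross≡0 , eq′ with m*n≡0⇒m≡0∨n≡0 (sqAbs z) cross≡0
  ...   | inj₂ rest≡0 = z , prep z (↭-reflexive (sum-sqAbs≡0⇒zeros (z′ ∷ w) rest≡0))
  ...   | inj₁ z²≡0 with sqAbs≡0⇒≡0 z z²≡0 | sum²≡sumSquares⇒oneNonzero z′ w eq′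
  ...     | refl | u , p = u , ↭-trans (prep 0ℤ p) (swap 0ℤ u ↭-refl)

  -- (Σ y²)² = Σ y⁴ leaves room for only one nonzero entry, and Σ y = c identifies it.
  single-PowerSumsAgree⇒↭ : ∀ c z w → PowerSumsAgree 4 (c ∷ []) (z ∷ w) →
    z ∷ w ↭ c ∷ replicate (length w) 0ℤ
  single-PowerSumsAgree⇒↭ c z w agree = subst (λ v → z ∷ w ↭ v ∷ replicate (length w) 0ℤ) (sym c≡u) p
    where
    open ≡-Reasoning
    l = z ∷ w
    S = sum (map sqAbs l)
    single-square : ∀ c → (c * (c * + 1) + 0ℤ) * (c * (c * + 1) + 0ℤ) ≡ c * (c * (c * (c * + 1))) + 0ℤ
    single-square = solve-∀
    single-power : ∀ x → x * + 1 + 0ℤ ≡ x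
    single-power = solve-∀
    p₂ : powerSumᴸ 2 (c ∷ []) ≡ + S
    p₂ = trans (agree 2 (s≤s z≤n) (s≤s (s≤s z≤n))) (powerSumᴸ-2 l)
    squares : S ℕ.* S ≡ sumSquares (map sqAbs l)
    squares = +-injective (begin
      + (S ℕ.* S)                                 ≡⟨ pos-* S S ⟩
      + S * + S                                   ≡⟨ cong₂ _*_ p₂ p₂ ⟨
      powerSumᴸ 2 (c ∷ []) * powerSumᴸ 2 (c ∷ [])   ≡⟨ single-square c ⟩
      powerSumᴸ 4 (c ∷ [])                         ≡⟨ agree 4 (s≤s z≤n) ≤-refl ⟩
      powerSumᴸ 4 l                               ≡⟨ powerSumᴸ-4 l ⟩
      + sumSquares (map sqAbs l)                  ∎)
    u = proj₁ (sum²≡sumSquares⇒oneNonzero z w squares)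
    p = proj₂ (sum²≡sumSquares⇒oneNonzero z w squares)
    c≡u : c ≡ u
    c≡u = begin
      c                                            ≡⟨ single-power c ⟨
      powerSumᴸ 1 (c ∷ [])                         ≡⟨ agree 1 (s≤s z≤n) (s≤s z≤n) ⟩
      powerSumᴸ 1 l                                ≡⟨ powerSumᴸ-↭ 1 p ⟩
      powerSumᴸ 1 (u ∷ replicate (length w) 0ℤ)   ≡⟨ powerSumᴸ-padded 0 (u ∷ []) (length w) ⟩
      powerSumᴸ 1 (u ∷ [])                         ≡⟨ single-power u ⟩
      u                                            ∎

open PowerSums using (PowerSumsAgree; powerSumᴸ-padded; PowerSumsAgree⇒↭; single-PowerSumsAgree⇒↭)
open import Data.Nat using (ℕ; suc; _≤_; _<_; _+_; _∸_; _≤?_; s≤s; s≤s⁻¹)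
open import Data.Nat.Properties
  using (≤-total; ≤-trans; ≰⇒>; ≤-antisym; +-comm; +-monoˡ-≤; +-monoʳ-≤; +-cancelʳ-≤; m+[n∸m]≡n;
         module ≤-Reasoning)
open import Data.Integer using (ℤ; 0ℤ)
open import Relation.Nullary using (yes; no)

βAtLeastOrd : ℕ → ℕ → Set
βAtLeastOrd k b = ∀ {s₁ s₂} → 1 ≤ s₁ → s₁ ≤ s₂ → s₁ + s₂ < b →
  (x : Vec ℤ s₁) (y : Vec ℤ s₂) → IsSolution k x y → TrivialOrd x y

βAtLeastOrd⇒βAtLeast : ∀ k b → βAtLeastOrd k b → βAtLeast k b
βAtLeastOrd⇒βAtLeast k b ordered s₁ s₂ 1≤s₁ 1≤s₂ s₁+s₂<b x y sol with ≤-total s₁ s₂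
... | inj₁ s₁≤s₂ = inj₁ (s₁≤s₂ , ordered 1≤s₁ s₁≤s₂ s₁+s₂<b x y sol)
... | inj₂ s₂≤s₁ = inj₂ (s₂≤s₁ , ordered 1≤s₂ s₂≤s₁ s₂+s₁<b y x (λ r 1≤r r≤k → sym (sol r 1≤r r≤k)))
  where
  s₂+s₁<b : s₂ + s₁ < b
  s₂+s₁<b = subst (_< b) (+-comm s₁ s₂) s₁+s₂<b

IsSolution⇒TrivialOrd : ∀ k {s₁ s₂} (x : Vec ℤ s₁) (y : Vec ℤ s₂) → s₁ ≤ s₂ → s₂ ≤ k →
  IsSolution k x y → TrivialOrd x y
IsSolution⇒TrivialOrd k {s₁} {s₂} x y s₁≤s₂ s₂≤k sol = PowerSumsAgree⇒↭ (length-toList y) padded-length agree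
  where
  padded-length : length (toList x ++ replicate (s₂ ∸ s₁) 0ℤ) ≡ s₂
  padded-length = trans (length-++ (toList x))
    (trans (cong₂ _+_ (length-toList x) (length-replicate (s₂ ∸ s₁))) (m+[n∸m]≡n s₁≤s₂))
  agree : PowerSumsAgree s₂ (toList y) (toList x ++ replicate (s₂ ∸ s₁) 0ℤ)
  agree (suc r) 1≤r r≤s₂ =
    sym (trans (powerSumᴸ-padded r (toList x) (s₂ ∸ s₁)) (sol (suc r) 1≤r (≤-trans r≤s₂ s₂≤k)))

IsSolution-single⇒TrivialOrd : ∀ k {s₂} (x : Vec ℤ 1) (y : Vec ℤ s₂) → 4 ≤ k → 1 ≤ s₂ →
  IsSolution k x y → TrivialOrd x y
IsSolution-single⇒TrivialOrd k (c ∷ []) (z ∷ w) 4≤k _ sol =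
  subst (λ n → z ∷ toList w ↭ c ∷ replicate n 0ℤ) (length-toList w)
    (single-PowerSumsAgree⇒↭ c z (toList w) (λ r 1≤r r≤4 → sol r 1≤r (≤-trans r≤4 4≤k)))

m+n<k+2⇒n≤k : ∀ {m n k} → 1 ≤ m → m + n < k + 2 → n ≤ k
m+n<k+2⇒n≤k {m} {n} {k} 1≤m m+n<k+2 = +-cancelʳ-≤ 2 n k (begin
  n + 2          ≡⟨ +-comm n 2 ⟩
  suc (1 + n)    ≤⟨ s≤s (+-monoˡ-≤ n 1≤m) ⟩
  suc (m + n)    ≤⟨ m+n<k+2 ⟩
  k + 2          ∎)
  where open ≤-Reasoning

m+n<k+3⇒k<n⇒m≡1 : ∀ {m n k} → 1 ≤ m → m + n < k + 3 → k < n → m ≡ 1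
m+n<k+3⇒k<n⇒m≡1 {m} {n} {k} 1≤m m+n<k+3 k<n = ≤-antisym (+-cancelʳ-≤ (suc k) m 1 (s≤s⁻¹ m+k+2≤k+3)) 1≤m
  where
  open ≤-Reasoning
  m+k+2≤k+3 : suc (m + suc k) ≤ suc (1 + suc k)
  m+k+2≤k+3 = begin
    suc (m + suc k)    ≤⟨ s≤s (+-monoʳ-≤ m k<n) ⟩
    suc (m + n)        ≤⟨ m+n<k+3 ⟩
    k + 3              ≡⟨ +-comm k 3 ⟩
    suc (1 + suc k)    ∎

corollary1 : (∀ k → 1 ≤ k → βAtLeast k (k + 2)) × (∀ k → 4 ≤ k → βAtLeast k (k + 3))
corollary1 = part₁ , part₂
  where
  part₁ : ∀ k → 1 ≤ k → βAtLeast k (k + 2)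
  part₁ k _ = βAtLeastOrd⇒βAtLeast k (k + 2) λ 1≤s₁ s₁≤s₂ s₁+s₂<k+2 x y →
    IsSolution⇒TrivialOrd k x y s₁≤s₂ (m+n<k+2⇒n≤k 1≤s₁ s₁+s₂<k+2)
  part₂ : ∀ k → 4 ≤ k → βAtLeast k (k + 3)
  part₂ k 4≤k = βAtLeastOrd⇒βAtLeast k (k + 3) ordered
    where
    ordered : βAtLeastOrd k (k + 3)
    ordered {s₁} {s₂} 1≤s₁ s₁≤s₂ s₁+s₂<k+3 x y with s₂ ≤? k
    ... | yes s₂≤k = IsSolution⇒TrivialOrd k x y s₁≤s₂ s₂≤k
    ... | no s₂≰k with m+n<k+3⇒k<n⇒m≡1 1≤s₁ s₁+s₂<k+3 (≰⇒> s₂≰k)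
    ...   | refl = IsSolution-single⇒TrivialOrd k x y 4≤k s₁≤s₂
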